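{- Let $S$ be a solid and let $x,y,z\in S$. Then $x(z+e(y))=xz+xe(y)$.
   Context: A solid is a set $S$ with binary operations $+$ and $\cdot$ and a relation $\le$ satisfying: (1) $+$ is associative and commutative; for every $x$ there is a unique $e$ with $x+e=x$ and $e+f=e$ whenever $x+f=x$, written $e(x)$ (the magnitude of $x$); for every $x$ there is $s$ with $x+s=e(x)$ and $e(s)=e(x)$, written $-x$; $e(x+y)=e(x)$ or $e(x+y)=e(y)$. (2) $\cdot$ is associative and commutative; for every $x\ne e(x)$ there is a unique $u$ with $xu=x$ and $uv=u$ whenever $xv=x$, written $u(x)$; for every $x\ne e(x)$ there is $d$ with $xd=u(x)$ and $u(d)=u(x)$, written $x^{ -1}$; for $x\ne e(x),y\ne e(y)$: $u(xy)=u(x)$ or $u(xy)=u(y)$. (3) $\le$ is a total order; $x\le y\Rightarrow x+z\le y+z$; $y+e(x)=e(x)\Rightarrow (y\le e(x)$ and $-y\le e(x))$; $(e(x)<x$ and $y\le z)\Rightarrow xy\le xz$; $e(y)\le y\le z\Rightarrow e(x)y\le e(x)z$. (4) For all $x,y$ there is $z$ with $e(x)y=e(z)$; $e(xy)=e(x)y+e(y)x$; for $x\ne e(x)$, $e(u(x))=e(x)x^{ -1}$; $xy+xz=x(y+z)+e(x)y+e(x)z$; $-(xy)=(-x)y$. (5) There is $0$ with $0+x=x$ for all $x$; there is $1$ with $1x=x$ for all $x$; there is $M$ with $e(x)+M=M$ for all $x$; there is $x$ with $e(x)\ne 0$ and $e(x)\ne M$; for every $x$ there is $a$ with $x=a+e(x)$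 and $e(a)=0$; if $x=e(x)$, $y=e(y)$ and $x<y$ then there is $z\ne e(z)$ with $x<z<y$. -}

module Defs where

open import Level using (Level; suc; _⊔_)
open import Relation.Binary.PropositionalEquality using (_≡_)
open import Relation.Nullary using (¬_)
open import Data.Product using (Σ; _×_; _,_; ∃)
open import Data.Sum using (_⊎_)

-- A solid (carrier with propositional equality).
-- e (magnitude), u (unity), neg (-x) and inv (x⁻¹) are given as operations
-- together with their defining properties; for e and u also the uniqueness
-- clause of the definition.  For neg and inv the paper only asserts existence,
-- so an operation picking a witness is equivalent (choice of witness).
record Solid (a : Level) : Set (suc a) where
  infixl 6 _+_
  infixl 7 _·_
  infix 4 _≤_ _<_
  field
    S    : Set a
    _+_  : S → S → S
    _·_  : S → S → S
    _≤_  : S → S → Set a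
    e    : S → S
    u    : S → S
    neg  : S → S
    inv  : S → S
    𝟘 𝟙 M : S

  _<_ : S → S → Set a
  x < y = (x ≤ y) × ¬ (x ≡ y)

  field
    +-assoc : ∀ x y z → (x + y) + z ≡ x + (y + z)
    +-comm  : ∀ x y → x + y ≡ y + x
    e-neutral : ∀ x → x + e x ≡ x
    e-minimal : ∀ x f → x + f ≡ x → e x + f ≡ e x
    e-unique  : ∀ x e′ → x + e′ ≡ x → (∀ f → x + f ≡ x → e′ + f ≡ e′) → e′ ≡ e x
    neg-inv   : ∀ x → x + neg x ≡ e x
    neg-e     : ∀ x → e (neg x) ≡ e x
    e-+       : ∀ x y → (e (x + y) ≡ e x) ⊎ (e (x + y) ≡ e y)
    ·-assoc : ∀ x y z → (x · y) · z ≡ x · (y · z)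
    ·-comm  : ∀ x y → x · y ≡ y · x
    u-neutral : ∀ x → ¬ (x ≡ e x) → x · u x ≡ x
    u-minimal : ∀ x v → ¬ (x ≡ e x) → x · v ≡ x → u x · v ≡ u x
    u-unique  : ∀ x u′ → ¬ (x ≡ e x) → x · u′ ≡ x → (∀ v → x · v ≡ x → u′ · v ≡ u′) → u′ ≡ u x
    inv-inv   : ∀ x → ¬ (x ≡ e x) → x · inv x ≡ u x
    inv-u     : ∀ x → ¬ (x ≡ e x) → u (inv x) ≡ u x
    u-·       : ∀ x y → ¬ (x ≡ e x) → ¬ (y ≡ e y) → (u (x · y) ≡ u x) ⊎ (u (x · y) ≡ u y)
    ≤-refl    : ∀ x → x ≤ x
    ≤-antisym : ∀ x y → x ≤ y → y ≤ x → x ≡ y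
    ≤-trans   : ∀ x y z → x ≤ y → y ≤ z → x ≤ z
    ≤-total   : ∀ x y → (x ≤ y) ⊎ (y ≤ x)
    +-mono    : ∀ x y z → x ≤ y → x + z ≤ y + z
    e-absorb-bound : ∀ x y → y + e x ≡ e x → (y ≤ e x) × (neg y ≤ e x)
    ·-mono    : ∀ x y z → e x < x → y ≤ z → x · y ≤ x · z
    e·-mono   : ∀ x y z → e y ≤ y → y ≤ z → e x · y ≤ e x · z
    e·-is-e   : ∀ x y → ∃ λ z → e x · y ≡ e z
    e-·       : ∀ x y → e (x · y) ≡ e x · y + e y · x
    e-u       : ∀ x → ¬ (x ≡ e x) → e (u x) ≡ e x · inv x
    distrib   : ∀ x y z → x · y + x · z ≡ x · (y + z) + e x · y + e x · z
    neg-·     : ∀ x y → neg (x · y) ≡ neg x · y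
    +-identity : ∀ x → 𝟘 + x ≡ x
    ·-identity : ∀ x → 𝟙 · x ≡ x
    M-absorb   : ∀ x → e x + M ≡ M
    nontrivial : ∃ λ x → ¬ (e x ≡ 𝟘) × ¬ (e x ≡ M)
    decomp     : ∀ x → ∃ λ a → (x ≡ a + e x) × (e a ≡ 𝟘)
    dense      : ∀ x y → x ≡ e x → y ≡ e y → x < y →
                 ∃ λ z → ¬ (z ≡ e z) × (x < z) × (z < y)

-- The distributivity axiom gives x·z + x·e(y) = x·(z + e(y)) + e(x)·z + e(x)·e(y),
-- so it suffices that both error terms e(x)·z and e(x)·e(y) are absorbed by the
-- magnitude of w = x·(z + e(y)), which by the product rule is
-- e(x)·(z + e(y)) + e(z + e(y))·x.  The first term dominates e(x)·z by monotonicity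
-- of multiplication by e(x) (for "negative" z one passes to -z, which e(x)·_ cannot
-- distinguish from z); the second dominates e(x)·e(y) because e(y) ≤ e(z + e(y)).
module Submission where

open import Defs
open import Level using (Level)
open import Relation.Binary.PropositionalEquality
  using (_≡_; sym; trans; cong; cong₂; subst; subst₂; isEquivalence; module ≡-Reasoning)
open import Data.Product using (_,_; proj₁)
open import Data.Sum using (inj₁; inj₂)
open import Algebra.Bundles using (CommutativeSemigroup)
import Algebra.Properties.CommutativeSemigroup as CommutativeSemigroupProperties

module SolidProperties {a : Level} (Sd : Solid a) where
  open Solid Sd
  open ≡-Reasoning

  +-commutativeSemigroup : CommutativeSemigroup a a
  +-commutativeSemigroup = record
    { isCommutativeSemigroup = record
      { isSemigroup = record
        { isMagma = record { isEquivalence = isEquivalence ; ∙-cong = cong₂ _+_ }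
        ; assoc   = +-assoc }
      ; comm = +-comm } }

  open CommutativeSemigroupProperties +-commutativeSemigroup using (interchange)

  IsMagnitude : S → Set a
  IsMagnitude A = e A ≡ A

  infix 4 _⊑_
  _⊑_ : S → S → Set a
  A ⊑ B = A + B ≡ B

  idempotent⇒magnitude : ∀ A → A + A ≡ A → IsMagnitude A
  idempotent⇒magnitude A idem = sym (e-unique A A idem (λ _ p → p))

  magnitude⇒idempotent : ∀ {A} → IsMagnitude A → A + A ≡ A
  magnitude⇒idempotent {A} mA = trans (cong (A +_) (sym mA)) (e-neutral A)

  e-magnitude : ∀ x → IsMagnitude (e x)
  e-magnitude x = idempotent⇒magnitude (e x) (e-minimal x (e x) (e-neutral x))

  ⊑-trans : ∀ {A B C} → A ⊑ B → B ⊑ C → A ⊑ C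
  ⊑-trans {A} {B} {C} A⊑B B⊑C = begin
    A + C        ≡⟨ cong (A +_) (sym B⊑C) ⟩
    A + (B + C)  ≡⟨ sym (+-assoc A B C) ⟩
    (A + B) + C  ≡⟨ cong (_+ C) A⊑B ⟩
    B + C        ≡⟨ B⊑C ⟩
    C            ∎

  x⊑x+y : ∀ {A} B → IsMagnitude A → A ⊑ A + B
  x⊑x+y {A} B mA = trans (sym (+-assoc A A B)) (cong (_+ B) (magnitude⇒idempotent mA))

  y⊑x+y : ∀ A {B} → IsMagnitude B → B ⊑ A + B
  y⊑x+y A {B} mB = begin
    B + (A + B)  ≡⟨ +-comm B (A + B) ⟩
    (A + B) + B  ≡⟨ +-assoc A B B ⟩
    A + (B + B)  ≡⟨ cong (A +_) (magnitude⇒idempotent mB) ⟩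
    A + B        ∎

  e+magnitudes : ∀ x y → e (x + y) + (e x + e y) ≡ e (x + y)
  e+magnitudes x y = e-minimal (x + y) (e x + e y)
    (trans (interchange x y (e x) (e y)) (cong₂ _+_ (e-neutral x) (e-neutral y)))

  e-distrib-+ : ∀ x y → e (x + y) ≡ e x + e y
  e-distrib-+ x y with e-+ x y
  ... | inj₁ eq = begin
    e (x + y)                ≡⟨ sym (e+magnitudes x y) ⟩
    e (x + y) + (e x + e y)  ≡⟨ cong (_+ (e x + e y)) eq ⟩
    e x + (e x + e y)        ≡⟨ x⊑x+y (e y) (e-magnitude x) ⟩
    e x + e y                ∎
  ... | inj₂ eq = begin
    e (x + y)                ≡⟨ sym (e+magnitudes x y) ⟩
    e (x + y) + (e x + e y)  ≡⟨ cong (_+ (e x + e y)) eq ⟩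
    e y + (e x + e y)        ≡⟨ y⊑x+y (e x) (e-magnitude y) ⟩
    e x + e y                ∎

  𝟘≤magnitude : ∀ {A} → IsMagnitude A → 𝟘 ≤ A
  𝟘≤magnitude {A} mA = subst (𝟘 ≤_) mA (proj₁ (e-absorb-bound A 𝟘 (+-identity (e A))))

  x≤x+magnitude : ∀ z {A} → IsMagnitude A → z ≤ z + A
  x≤x+magnitude z {A} mA =
    subst₂ _≤_ (+-identity z) (+-comm A z) (+-mono 𝟘 A z (𝟘≤magnitude mA))

  ⊑⇒≤ : ∀ {A B} → IsMagnitude B → A ⊑ B → A ≤ B
  ⊑⇒≤ {A} mB A⊑B = subst (A ≤_) A⊑B (x≤x+magnitude A mB)

  ≤⇒⊑ : ∀ {A B} → IsMagnitude A → IsMagnitude B → A ≤ B → A ⊑ B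
  ≤⇒⊑ {A} {B} mA mB A≤B with e-+ A B
  ... | inj₂ eq = trans (sym magnitudeA+B) (trans eq mB)
    where
    magnitudeA+B : IsMagnitude (A + B)
    magnitudeA+B = trans (e-distrib-+ A B) (cong₂ _+_ mA mB)
  ... | inj₁ eq = trans (cong (_+ B) A≡B) (magnitude⇒idempotent mB)
    where
    B⊑A : B ⊑ A
    B⊑A = begin
      B + A      ≡⟨ +-comm B A ⟩
      A + B      ≡⟨ sym (cong₂ _+_ mA mB) ⟩
      e A + e B  ≡⟨ sym (e-distrib-+ A B) ⟩
      e (A + B)  ≡⟨ trans eq mA ⟩
      A          ∎
    A≡B : A ≡ B
    A≡B = ≤-antisym A B A≤B
      (subst (B ≤_) mA (proj₁ (e-absorb-bound A B (subst (λ C → B + C ≡ C) (sym mA) B⊑A))))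

  ⊑e⇒absorbed : ∀ w {A} → A ⊑ e w → w + A ≡ w
  ⊑e⇒absorbed w {A} A⊑ew = begin
    w + A            ≡⟨ cong (_+ A) (sym (e-neutral w)) ⟩
    (w + e w) + A    ≡⟨ +-assoc w (e w) A ⟩
    w + (e w + A)    ≡⟨ cong (w +_) (+-comm (e w) A) ⟩
    w + (A + e w)    ≡⟨ cong (w +_) A⊑ew ⟩
    w + e w          ≡⟨ e-neutral w ⟩
    w                ∎

  neg-magnitude : ∀ {A} → IsMagnitude A → neg A ≡ A
  neg-magnitude {A} mA = begin
    neg A                ≡⟨ sym (e-neutral (neg A)) ⟩
    neg A + e (neg A)    ≡⟨ cong (neg A +_) (trans (neg-e A) mA) ⟩
    neg A + A            ≡⟨ +-comm (neg A) A ⟩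
    A + neg A            ≡⟨ neg-inv A ⟩
    e A                  ≡⟨ mA ⟩
    A                    ∎

  neg-unique : ∀ t s → t + s ≡ e t → e s ≡ e t → s ≡ neg t
  neg-unique t s t+s≡et es≡et = begin
    s                  ≡⟨ sym (e-neutral s) ⟩
    s + e s            ≡⟨ cong (s +_) (trans es≡et (sym (neg-inv t))) ⟩
    s + (t + neg t)    ≡⟨ sym (+-assoc s t (neg t)) ⟩
    (s + t) + neg t    ≡⟨ cong (_+ neg t) (trans (+-comm s t) t+s≡et) ⟩
    e t + neg t        ≡⟨ cong (_+ neg t) (sym (neg-e t)) ⟩
    e (neg t) + neg t  ≡⟨ trans (+-comm (e (neg t)) (neg t)) (e-neutral (neg t)) ⟩
    neg t              ∎

  neg-distrib-+magnitude : ∀ z {A} → IsMagnitude A → neg (z + A) ≡ neg z + A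
  neg-distrib-+magnitude z {A} mA = sym (neg-unique (z + A) (neg z + A) inverse magnitude)
    where
    eA≡ : e z + A ≡ e (z + A)
    eA≡ = sym (trans (e-distrib-+ z A) (cong (e z +_) mA))
    inverse : (z + A) + (neg z + A) ≡ e (z + A)
    inverse = begin
      (z + A) + (neg z + A)  ≡⟨ interchange z A (neg z) A ⟩
      (z + neg z) + (A + A)  ≡⟨ cong₂ _+_ (neg-inv z) (magnitude⇒idempotent mA) ⟩
      e z + A                ≡⟨ eA≡ ⟩
      e (z + A)              ∎
    magnitude : e (neg z + A) ≡ e (z + A)
    magnitude = begin
      e (neg z + A)      ≡⟨ e-distrib-+ (neg z) A ⟩
      e (neg z) + e A    ≡⟨ cong₂ _+_ (neg-e z) mA ⟩
      e z + A            ≡⟨ eA≡ ⟩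
      e (z + A)          ∎

  ≤e⇒e≤neg : ∀ z → z ≤ e z → e (neg z) ≤ neg z
  ≤e⇒e≤neg z z≤ez = subst₂ _≤_ (trans (neg-inv z) (sym (neg-e z))) ez+negz≡negz
    (+-mono z (e z) (neg z) z≤ez)
    where
    ez+negz≡negz : e z + neg z ≡ neg z
    ez+negz≡negz = begin
      e z + neg z        ≡⟨ cong (_+ neg z) (sym (neg-e z)) ⟩
      e (neg z) + neg z  ≡⟨ +-comm (e (neg z)) (neg z) ⟩
      neg z + e (neg z)  ≡⟨ e-neutral (neg z) ⟩
      neg z              ∎

  e·-magnitude : ∀ x t → IsMagnitude (e x · t)
  e·-magnitude x t with e·-is-e x t
  ... | z , eq = subst IsMagnitude (sym eq) (e-magnitude z)

  e·-neg : ∀ x t → e x · neg t ≡ e x · t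
  e·-neg x t = begin
    e x · neg t    ≡⟨ ·-comm (e x) (neg t) ⟩
    neg t · e x    ≡⟨ sym (neg-· t (e x)) ⟩
    neg (t · e x)  ≡⟨ cong neg (·-comm t (e x)) ⟩
    neg (e x · t)  ≡⟨ neg-magnitude (e·-magnitude x t) ⟩
    e x · t        ∎

  e·-mono-+magnitude : ∀ x z {A} → IsMagnitude A → e x · z ≤ e x · (z + A)
  e·-mono-+magnitude x z {A} mA with ≤-total (e z) z
  ... | inj₁ ez≤z = e·-mono x z (z + A) ez≤z (x≤x+magnitude z mA)
  ... | inj₂ z≤ez = subst₂ _≤_ (e·-neg x z) ex·[negz+A]≡ex·[z+A]
    (e·-mono x (neg z) (neg z + A) (≤e⇒e≤neg z z≤ez) (x≤x+magnitude (neg z) mA))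
    where
    ex·[negz+A]≡ex·[z+A] : e x · (neg z + A) ≡ e x · (z + A)
    ex·[negz+A]≡ex·[z+A] =
      trans (cong (e x ·_) (sym (neg-distrib-+magnitude z mA))) (e·-neg x (z + A))

  e·⊑magnitude· : ∀ x {A} → IsMagnitude A → e x · A ⊑ A · x
  e·⊑magnitude· x {A} mA = begin
    e x · A + A · x    ≡⟨ +-comm (e x · A) (A · x) ⟩
    A · x + e x · A    ≡⟨ cong (λ B → B · x + e x · A) (sym mA) ⟩
    e A · x + e x · A  ≡⟨ sym (e-· A x) ⟩
    e (A · x)          ≡⟨ trans (cong (λ B → e (B · x)) (sym mA)) (e·-magnitude A x) ⟩
    e A · x            ≡⟨ cong (_· x) mA ⟩
    A · x              ∎

  e·⊑e· : ∀ x t → e x · t ⊑ e (x · t)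
  e·⊑e· x t = subst (e x · t ⊑_) (sym (e-· x t)) (x⊑x+y (e t · x) (e·-magnitude x t))

  e·⊑e·+magnitude : ∀ x z {A} → IsMagnitude A → e x · z ⊑ e (x · (z + A))
  e·⊑e·+magnitude x z mA = ⊑-trans
    (≤⇒⊑ (e·-magnitude x z) (e·-magnitude x _) (e·-mono-+magnitude x z mA))
    (e·⊑e· x _)

  e·magnitude⊑e· : ∀ x t {A} → IsMagnitude A → A ⊑ e t → e x · A ⊑ e (x · t)
  e·magnitude⊑e· x t {A} mA A⊑et =
    ⊑-trans (≤⇒⊑ (e·-magnitude x A) (e·-magnitude x (e t)) ex·A≤ex·et)
      (⊑-trans (e·⊑magnitude· x (e-magnitude t)) et·x⊑e[x·t])
    where
    ex·A≤ex·et : e x · A ≤ e x · e t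
    ex·A≤ex·et = e·-mono x A (e t) (subst (e A ≤_) mA (≤-refl (e A))) (⊑⇒≤ (e-magnitude t) A⊑et)
    et·x⊑e[x·t] : e t · x ⊑ e (x · t)
    et·x⊑e[x·t] = subst (e t · x ⊑_) (sym (e-· x t)) (y⊑x+y (e x · t) (e·-magnitude t x))

  e⊑e+e : ∀ z y → e y ⊑ e (z + e y)
  e⊑e+e z y = subst (e y ⊑_) (sym (trans (e-distrib-+ z (e y)) (cong (e z +_) (e-magnitude y))))
    (y⊑x+y (e z) (e-magnitude y))

proposition4p7 : ∀ {a : Level} (Sd : Solid a) → let open Solid Sd in
    ∀ (x y z : S) → x · (z + e y) ≡ x · z + x · e y
proposition4p7 Sd x y z = begin
  w                        ≡⟨ sym (⊑e⇒absorbed w ex·ey⊑ew) ⟩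
  w + e x · e y            ≡⟨ cong (_+ e x · e y) (sym (⊑e⇒absorbed w ex·z⊑ew)) ⟩
  w + e x · z + e x · e y  ≡⟨ sym (distrib x z (e y)) ⟩
  x · z + x · e y          ∎
  where
  open Solid Sd
  open SolidProperties Sd
  open ≡-Reasoning
  w : S
  w = x · (z + e y)
  ex·z⊑ew : e x · z ⊑ e w
  ex·z⊑ew = e·⊑e·+magnitude x z (e-magnitude y)
  ex·ey⊑ew : e x · e y ⊑ e w
  ex·ey⊑ew = e·magnitude⊑e· x (z + e y) (e-magnitude y) (e⊑e+e z y)
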